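{- Let $0\leq\ell\leq\ell'$ be integers and let $e$ be a boring extension of $\Sigma^*_\ell=\{u^0<_{\mathrm{lex}}u^1<_{\mathrm{lex}}\cdots<_{\mathrm{lex}}u^{n-1}\}$. Write $\Sigma^*_{\ell'}=\{v^0<_{\mathrm{lex}}\cdots<_{\mathrm{lex}}v^{m-1}\}$ and define the word $e'$ of length $m$ by $e'_i=e_j$, where $j$ is such that $v^i|_\ell=u^j$ ($0\leq i<m$). Then $e'$ is a boring extension of $\Sigma^*_{\ell'}$.
   Context: Let $\Sigma=\{\mathrm L,\mathrm X,\mathrm R\}$ with $\mathrm L<_{\mathrm{lex}}\mathrm X<_{\mathrm{lex}}\mathrm R$; $\Sigma^*$ finite words with lexicographic order $\leq_{\mathrm{lex}}$; $|w|$ length; $w|_i$ initial segment of length $i$; $\Sigma^*_\ell$ words of length $\ell$. For $S\subseteq\Sigma^*$, $\overline S=\{w|_i:w\in S,0\leq i\leq|w|\}$ and $\overline S_i$ its words of length $i$. $w\prec w'$ iff there is $i<\min(|w|,|w'|)$ with $(w_i,w'_i)=(\mathrm L,\mathrm R)$ and $w_j\leq_{\mathrm{lex}}w'_j$ for all $j<i$; $w\preceq w'$ iff $w\prec w'$ or $w=w'$. For words of equal length $\ell$: $w\trianglelefteq w'$ iff $w_i\leq_{\mathrm{lex}}w'_i$ for all $i<\ell$. For $A\subseteq\Sigma^*_i$, the level structure of $A$ is $(A,\leq_{\mathrm{lex}},\preceq,\trianglelefteq)$. Words $u\leq_{\mathrm{lex}}v$ are compatible if (1) no $k<\min(|u|,|v|)$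 has $(u_k,v_k)=(\mathrm R,\mathrm L)$ and (2) if some $k'<\min(|u|,|v|)$ has $(u_{k'},v_{k'})=(\mathrm L,\mathrm R)$ then $u_{k''}\leq_{\mathrm{lex}}v_{k''}$ for all $k''<\min(|u|,|v|)$. Interesting levels: for $S\subseteq\Sigma^*$, a level $i\geq0$ is interesting if (1) the level structures of $\overline S_i$ and $\overline S_{i+1}$ are not isomorphic, or (2) there are incompatible $u,v\in\overline S_{i+1}$ with $u|_i,v|_i$ compatible, or (3) some $u\in S$ has $|u|=i$. Boring extensions: for $A=\{a^0<_{\mathrm{lex}}\cdots<_{\mathrm{lex}}a^{n-1}\}\subseteq\Sigma^*_\ell$ and $e\in\Sigma^*_n$ put $A^\frown e=\{(a^i)^\frown e_i:0\leq i<n\}$ ($a^i$ followed by the letter $e_i$). The word $e$ is a boring extension of $A$ if level $\ell$ of the set $A^\frown e$ is not interesting. -}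

module Defs where

open import Data.Nat using (ℕ; zero; suc; _≤_; _<_; _≡ᵇ_)
open import Data.Bool using (Bool; true; false; _∧_; _∨_; T)
open import Data.List using (List; []; _∷_; _++_; [_]; length; take; zip; map; concatMap)
open import Data.Bool.ListAction using (any)
open import Data.List.Membership.Propositional using (_∈_)
open import Data.Vec using (Vec)
import Data.Vec as Vec
open import Data.Fin using (Fin; toℕ)
open import Data.Product using (Σ; ∃; ∃-syntax; _×_; _,_; proj₁; proj₂)
open import Data.Sum using (_⊎_)
open import Data.Empty using (⊥)
open import Data.Unit using (⊤)
open import Relation.Nullary using (¬_)
open import Relation.Binary.PropositionalEquality using (_≡_)
open import Function.Bundles using (_↔_; _⇔_; Inverse)

data Sym : Set where
  L X R : Sym

rank : Sym → ℕ
rank L = 0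
rank X = 1
rank R = 2

_≤ₛ_ : Sym → Sym → Set
c ≤ₛ d = rank c ≤ rank d

_<ₛ_ : Sym → Sym → Set
c <ₛ d = rank c < rank d

_==ₛ_ : Sym → Sym → Bool
L ==ₛ L = true
X ==ₛ X = true
R ==ₛ R = true
_ ==ₛ _ = false

Word : Set
Word = List Sym

data _≤lex_ : Word → Word → Set where
  []≤   : ∀ {w} → [] ≤lex w
  head< : ∀ {c d w v} → c <ₛ d → (c ∷ w) ≤lex (d ∷ v)
  head≡ : ∀ {c w v} → w ≤lex v → (c ∷ w) ≤lex (c ∷ v)

_∣_ : Word → ℕ → Word
w ∣ i = take i w

pairs : Word → Word → List (Sym × Sym)
pairs = zip

pairAt : (w w' : Word) → Fin (length (pairs w w')) → Sym × Sym
pairAt w w' k = Data.List.lookup (pairs w w') k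

_≺_ : Word → Word → Set
w ≺ w' = ∃[ i ] (pairAt w w' i ≡ (L , R)
           × (∀ j → toℕ j < toℕ i → proj₁ (pairAt w w' j) ≤ₛ proj₂ (pairAt w w' j)))

_≼_ : Word → Word → Set
w ≼ w' = (w ≺ w') ⊎ (w ≡ w')

-- w ⊴ w' (used for words of equal length)
_⊴_ : Word → Word → Set
w ⊴ w' = ∀ i → proj₁ (pairAt w w' i) ≤ₛ proj₂ (pairAt w w' i)

-- compatibility (for u ≤lex v)
Compatible : Word → Word → Set
Compatible u v =
  (¬ (∃[ k ] (pairAt u v k ≡ (R , L))))
  × ((∃[ k' ] (pairAt u v k' ≡ (L , R))) →
       ∀ k'' → proj₁ (pairAt u v k'') ≤ₛ proj₂ (pairAt u v k''))

Subset : Set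
Subset = Word → Bool

El : Subset → Set
El A = Σ Word (λ w → T (A w))

isPrefix : Word → Word → Bool
isPrefix [] _ = true
isPrefix (c ∷ w) [] = false
isPrefix (c ∷ w) (d ∷ v) = (c ==ₛ d) ∧ isPrefix w v

closure : List Word → Subset
closure S w = any (isPrefix w) S

levelOf : Subset → ℕ → Subset
levelOf A i w = A w ∧ (length w ≡ᵇ i)

LevelIso : Subset → Subset → Set
LevelIso A B = Σ (El A ↔ El B) λ f →
  let g = Inverse.to f in
  ∀ x y →
    ((proj₁ x ≤lex proj₁ y) ⇔ (proj₁ (g x) ≤lex proj₁ (g y)))
  × ((proj₁ x ≼ proj₁ y) ⇔ (proj₁ (g x) ≼ proj₁ (g y)))
  × ((proj₁ x ⊴ proj₁ y) ⇔ (proj₁ (g x) ⊴ proj₁ (g y)))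

Interesting : List Word → ℕ → Set
Interesting S i =
  (¬ LevelIso (levelOf (closure S) i) (levelOf (closure S) (suc i)))
  ⊎ (∃[ u ] ∃[ v ] (T (levelOf (closure S) (suc i) u) × T (levelOf (closure S) (suc i) v)
        × u ≤lex v × (¬ Compatible u v) × Compatible (u ∣ i) (v ∣ i)))
  ⊎ (∃[ u ] (u ∈ S × length u ≡ i))

-- Σ*_ℓ listed in lexicographic order
allWords : ℕ → List Word
allWords zero = [ [] ]
allWords (suc ℓ) = concatMap (λ c → map (c ∷_) (allWords ℓ)) (L ∷ X ∷ R ∷ [])

-- A⌢e for A = {a⁰ <lex ... <lex aⁿ⁻¹} given as a lex-sorted list
extend : (A : List Word) → Vec Sym (length A) → List Word
extend [] Vec.[] = []
extend (a ∷ A) (c Vec.∷ e) = (a ++ [ c ]) ∷ extend A e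

Boring : ℕ → (A : List Word) → Vec Sym (length A) → Set
Boring ℓ A e = ¬ Interesting (extend A e) ℓ

-- Writing F w for the letter that e appends to w ∈ Σ*_ℓ, level ℓ of Σ*_ℓ⌢e is Σ*_ℓ and
-- level ℓ+1 is {w F(w)}. Both are chains for ≤lex and a lex-automorphism of Σ*_ℓ is
-- trivial, so the only candidate isomorphism of level structures is w ↦ w F(w). Hence e
-- is boring iff F is ⊴-monotone, F w = L, F v = R and w ⊴ v force w ≺ v, and appending F
-- preserves compatibility. Whether two words are ⊴- or ≺-related or compatible is read
-- off their list of letter pairs, and the pairs of u|ℓ, v|ℓ form a prefix of those of
-- u, v; this carries each condition from F to w ↦ F(w|ℓ), the letter that e' appends.
module Submission where

open import Defs
open import Data.Nat using (ℕ; zero; suc; _≤_; _<_; _+_; _*_; _^_; z≤n; s≤s; z<s; s<s; _≤?_; _≟_)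
open import Data.Nat.Properties
  using (≤-reflexive; <⇒≤; <⇒≱; ≰⇒>; <-irrefl; <-cmp; <-≤-trans; m≤n⇒m<n∨m≡n; m≤n⇒m⊓n≡m;
         suc-injective; +-comm; +-monoʳ-<; +-cancelˡ-≤; *-monoˡ-≤; m≤m+n; 1+n≢n; ≡ᵇ⇒≡; ≡⇒≡ᵇ;
         module ≤-Reasoning)
open import Data.Nat.Induction using (<-wellFounded)
open import Induction.WellFounded using (Acc; acc)
open import Data.Bool using (T)
import Data.Bool.Properties as Bool
open import Data.Unit using (tt)
open import Data.Empty using (⊥-elim)
open import Data.Fin as Fin using (Fin; toℕ)
open import Data.List using (List; []; _∷_; _++_; _∷ʳ_; length; lookup; take; drop; map; concatMap)
open import Data.List.Properties using (≡-dec; ∷-injective; ∷ʳ-injectiveˡ; length-take; zipWith-zeroʳ)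
open import Data.List.Relation.Unary.All as All using (All; []; _∷_; all?)
open import Data.List.Relation.Unary.All.Properties using (++⁻ˡ; ∷ʳ⁺; ∷ʳ⁻)
open import Data.List.Relation.Unary.Any as Any using (Any; here; there)
open import Data.List.Relation.Unary.Any.Properties using (lookup-index; any⁺; any⁻)
open import Data.List.Relation.Unary.AllPairs using ([]; _∷_)
open import Data.List.Relation.Unary.Unique.Propositional using (Unique)
import Data.List.Relation.Unary.Unique.Propositional.Properties as Unique
open import Data.List.Relation.Binary.Disjoint.Propositional using (Disjoint)
open import Data.List.Membership.Propositional using (_∈_; _∉_; find; lose)
open import Data.List.Membership.Propositional.Properties
  using (∈-lookup; ∈-++⁺ˡ; ∈-++⁺ʳ; ∈-++⁻; ∈-map⁺; ∈-map⁻)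
open import Data.Vec using (Vec)
import Data.Vec as Vec
open import Data.Product using (∃-syntax; _×_; _,_; proj₁; proj₂)
import Data.Product as Product
open import Data.Sum using (_⊎_; inj₁; inj₂)
import Data.Sum as Sum
open import Function using (_∘_; id)
open import Function.Bundles using (Equivalence; Inverse; _⇔_; mk⇔; mk↔ₛ′)
open import Relation.Nullary using (¬_; yes; no)
open import Relation.Nullary.Decidable using (decidable-stable; map′)
open import Relation.Binary.Definitions using (DecidableEquality; tri<; tri≈; tri>)
open import Relation.Binary.PropositionalEquality
  using (_≡_; _≢_; refl; sym; trans; cong; cong₂; subst; subst₂; module ≡-Reasoning)

rank-injective : ∀ {c d} → rank c ≡ rank d → c ≡ d
rank-injective {L} {L} _ = refl
rank-injective {X} {X} _ = refl
rank-injective {R} {R} _ = refl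
rank-injective {L} {X} ()
rank-injective {L} {R} ()
rank-injective {X} {L} ()
rank-injective {X} {R} ()
rank-injective {R} {L} ()
rank-injective {R} {X} ()

rank≤2 : ∀ c → rank c ≤ 2
rank≤2 L = z≤n
rank≤2 X = s≤s z≤n
rank≤2 R = s≤s (s≤s z≤n)

_≟ₛ_ : DecidableEquality Sym
c ≟ₛ d = map′ rank-injective (cong rank) (rank c ≟ rank d)

≤ₛ⇒<ₛ⊎≡ : ∀ {c d} → c ≤ₛ d → c <ₛ d ⊎ c ≡ d
≤ₛ⇒<ₛ⊎≡ = Sum.map₂ rank-injective ∘ m≤n⇒m<n∨m≡n

==ₛ-refl : ∀ c → T (c ==ₛ c)
==ₛ-refl L = tt
==ₛ-refl X = tt
==ₛ-refl R = tt

==ₛ⇒≡ : ∀ c d → T (c ==ₛ d) → c ≡ d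
==ₛ⇒≡ L L _ = refl
==ₛ⇒≡ X X _ = refl
==ₛ⇒≡ R R _ = refl

open import Data.List.Membership.DecPropositional (≡-dec _≟ₛ_) using (_∈?_)

-- Letter pairs

Ordered : Sym × Sym → Set
Ordered p = proj₁ p ≤ₛ proj₂ p

Pairs : Set
Pairs = List (Sym × Sym)

data Crosses : Pairs → Set where
  cross : ∀ {ps} → Crosses ((L , R) ∷ ps)
  pass  : ∀ {p ps} → Ordered p → Crosses ps → Crosses (p ∷ ps)

Compat : Pairs → Set
Compat ps = (R , L) ∉ ps × ((L , R) ∈ ps → All Ordered ps)

crosses⇒∈ : ∀ {ps} → Crosses ps → (L , R) ∈ ps
crosses⇒∈ cross = here refl
crosses⇒∈ (pass _ c) = there (crosses⇒∈ c)

crosses-++ : ∀ {ps} qs → Crosses ps → Crosses (ps ++ qs)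
crosses-++ qs cross = cross
crosses-++ qs (pass o c) = pass o (crosses-++ qs c)

crosses-∷ʳ : ∀ {ps} → All Ordered ps → Crosses (ps ∷ʳ (L , R))
crosses-∷ʳ [] = cross
crosses-∷ʳ (o ∷ os) = pass o (crosses-∷ʳ os)

crosses-∷ʳ⁻ : ∀ ps {q} → Crosses (ps ∷ʳ q) → Crosses ps ⊎ (All Ordered ps × q ≡ (L , R))
crosses-∷ʳ⁻ [] cross = inj₂ ([] , refl)
crosses-∷ʳ⁻ [] (pass _ ())
crosses-∷ʳ⁻ (_ ∷ _) cross = inj₁ cross
crosses-∷ʳ⁻ (_ ∷ ps) (pass o c) = Sum.map (pass o) (Product.map₁ (o ∷_)) (crosses-∷ʳ⁻ ps c)

compat-++⁻ˡ : ∀ qs {rs} → Compat (qs ++ rs) → Compat qs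
compat-++⁻ˡ qs (noRL , LR⇒ordered) =
  (noRL ∘ ∈-++⁺ˡ) , (++⁻ˡ qs ∘ LR⇒ordered ∘ ∈-++⁺ˡ)

compat-stable : ∀ {ps} → ¬ ¬ Compat ps → Compat ps
compat-stable ¬¬c =
    (λ RL∈ → ¬¬c λ c → proj₁ c RL∈)
  , (λ LR∈ → decidable-stable (all? (λ p → rank (proj₁ p) ≤? rank (proj₂ p)) _)
                                λ ¬ordered → ¬¬c λ c → ¬ordered (proj₂ c LR∈))

-- A final (L , R) forces qs to be ordered, hence to cross, so an (L , R)
-- already occurs in qs ++ rs.
compat-∷ʳ : ∀ qs rs {x} → Compat (qs ++ rs) → Compat (qs ∷ʳ x)
  → (All Ordered qs → Ordered x)
  → (All Ordered qs → x ≡ (L , R) → Crosses qs)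
  → Compat ((qs ++ rs) ∷ʳ x)
compat-∷ʳ qs rs {x} (noRL , LR⇒ordered) (noRLₓ , LR⇒orderedₓ) ordered-x crosses-qs =
  noRL′ , LR⇒ordered′
  where
  noRL′ : (R , L) ∉ (qs ++ rs) ∷ʳ x
  noRL′ RL∈ with ∈-++⁻ (qs ++ rs) RL∈
  ... | inj₁ RL∈ps = noRL RL∈ps
  ... | inj₂ RL∈x = noRLₓ (∈-++⁺ʳ qs RL∈x)

  ordered-ps : (L , R) ∈ (qs ++ rs) ∷ʳ x → All Ordered (qs ++ rs)
  ordered-ps LR∈ with ∈-++⁻ (qs ++ rs) LR∈
  ... | inj₁ LR∈ps = LR⇒ordered LR∈ps
  ... | inj₂ (here LR≡x) =
    LR⇒ordered (crosses⇒∈ (crosses-++ rs (crosses-qs ordered-qs (sym LR≡x))))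
    where
    ordered-qs : All Ordered qs
    ordered-qs = proj₁ (∷ʳ⁻ (LR⇒orderedₓ (∈-++⁺ʳ qs (here LR≡x))))

  LR⇒ordered′ : (L , R) ∈ (qs ++ rs) ∷ʳ x → All Ordered ((qs ++ rs) ∷ʳ x)
  LR⇒ordered′ LR∈ = ∷ʳ⁺ (ordered-ps LR∈) (ordered-x (++⁻ˡ qs (ordered-ps LR∈)))

All⇔lookup : ∀ {P : Sym × Sym → Set} (ps : Pairs) → All P ps ⇔ (∀ i → P (lookup ps i))
All⇔lookup {P} ps = mk⇔
  (λ all i → All.lookup all (∈-lookup i))
  (λ f → All.tabulate λ p∈ → subst P (sym (lookup-index p∈)) (f (Any.index p∈)))

∈⇔lookup : ∀ {p} (ps : Pairs) → p ∈ ps ⇔ (∃[ i ] (lookup ps i ≡ p))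
∈⇔lookup ps = mk⇔
  (λ p∈ → Any.index p∈ , sym (lookup-index p∈))
  (λ { (i , refl) → ∈-lookup i })

⊴⇔ordered : ∀ w v → w ⊴ v ⇔ All Ordered (pairs w v)
⊴⇔ordered w v = mk⇔ (Equivalence.from (All⇔lookup (pairs w v))) (Equivalence.to (All⇔lookup (pairs w v)))

≺⇔crosses : ∀ w v → w ≺ v ⇔ Crosses (pairs w v)
≺⇔crosses w v = mk⇔ (toCrosses (pairs w v)) fromCrosses
  where
  CrossesAt : Pairs → Set
  CrossesAt ps = ∃[ i ] (lookup ps i ≡ (L , R) × ∀ j → toℕ j < toℕ i → Ordered (lookup ps j))

  toCrosses : ∀ ps → CrossesAt ps → Crosses ps
  toCrosses (_ ∷ _) (Fin.zero , refl , _) = cross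
  toCrosses (_ ∷ ps) (Fin.suc i , LR , before) =
    pass (before Fin.zero z<s) (toCrosses ps (i , LR , λ j j<i → before (Fin.suc j) (s<s j<i)))

  fromCrosses : ∀ {ps} → Crosses ps → CrossesAt ps
  fromCrosses cross = Fin.zero , refl , λ _ ()
  fromCrosses (pass o c) with fromCrosses c
  ... | i , LR , before = Fin.suc i , LR , λ { Fin.zero _ → o ; (Fin.suc j) (s<s j<i) → before j j<i }

compatible⇔compat : ∀ u v → Compatible u v ⇔ Compat (pairs u v)
compatible⇔compat u v = mk⇔
  (λ (noRL , LR⇒ordered) →
     noRL ∘ to (∈⇔lookup ps) , from (All⇔lookup ps) ∘ LR⇒ordered ∘ to (∈⇔lookup ps))
  (λ (noRL , LR⇒ordered) →
     noRL ∘ from (∈⇔lookup ps) , to (All⇔lookup ps) ∘ LR⇒ordered ∘ from (∈⇔lookup ps))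
  where
  open Equivalence
  ps : Pairs
  ps = pairs u v

pairs-∷ʳ : ∀ (w v : Word) {c d} → length w ≡ length v
  → pairs (w ∷ʳ c) (v ∷ʳ d) ≡ pairs w v ∷ʳ (c , d)
pairs-∷ʳ [] [] _ = refl
pairs-∷ʳ (a ∷ w) (b ∷ v) eq = cong ((a , b) ∷_) (pairs-∷ʳ w v (suc-injective eq))

pairs-take++drop : ∀ n (w v : Word) → pairs (take n w) (take n v) ++ pairs (drop n w) (drop n v) ≡ pairs w v
pairs-take++drop zero w v = refl
pairs-take++drop (suc n) [] v = refl
pairs-take++drop (suc n) (a ∷ w) [] = zipWith-zeroʳ _,_ (drop n w)
pairs-take++drop (suc n) (a ∷ w) (b ∷ v) = cong ((a , b) ∷_) (pairs-take++drop n w v)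

ordered-take : ∀ n (w v : Word) → All Ordered (pairs w v) → All Ordered (pairs (take n w) (take n v))
ordered-take n w v = ++⁻ˡ _ ∘ subst (All Ordered) (sym (pairs-take++drop n w v))

crosses-take : ∀ n (w v : Word) → Crosses (pairs (take n w) (take n v)) → Crosses (pairs w v)
crosses-take n w v = subst Crosses (pairs-take++drop n w v) ∘ crosses-++ _

compat-take : ∀ n (w v : Word) → Compat (pairs w v) → Compat (pairs (take n w) (take n v))
compat-take n w v = compat-++⁻ˡ _ ∘ subst Compat (sym (pairs-take++drop n w v))

take-∷ʳ : ∀ {n} (w : Word) {c} → length w ≡ n → take n (w ∷ʳ c) ≡ w
take-∷ʳ [] refl = refl
take-∷ʳ (a ∷ w) refl = cong (a ∷_) (take-∷ʳ w refl)

length-take-≤ : ∀ {n} (w : Word) → n ≤ length w → length (take n w) ≡ n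
length-take-≤ {n} w n≤ = trans (length-take n w) (m≤n⇒m⊓n≡m n≤)

lex-antisym : ∀ {w v} → w ≤lex v → v ≤lex w → w ≡ v
lex-antisym []≤ []≤ = refl
lex-antisym (head< c<d) (head< d<c) = ⊥-elim (<⇒≱ c<d (<⇒≤ d<c))
lex-antisym (head< c<c) (head≡ _) = ⊥-elim (<-irrefl refl c<c)
lex-antisym (head≡ _) (head< c<c) = ⊥-elim (<-irrefl refl c<c)
lex-antisym (head≡ w≤v) (head≡ v≤w) = cong (_ ∷_) (lex-antisym w≤v v≤w)

lex-take : ∀ n {w v} → w ≤lex v → take n w ≤lex take n v
lex-take zero _ = []≤
lex-take (suc n) []≤ = []≤
lex-take (suc n) (head< c<d) = head< c<d
lex-take (suc n) (head≡ w≤v) = head≡ (lex-take n w≤v)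

lex-∷ʳ⁻ : ∀ w v {c d} → length w ≡ length v → (w ∷ʳ c) ≤lex (v ∷ʳ d) → w ≤lex v
lex-∷ʳ⁻ [] v _ _ = []≤
lex-∷ʳ⁻ (a ∷ w) (b ∷ v) _ (head< a<b) = head< a<b
lex-∷ʳ⁻ (a ∷ w) (.a ∷ v) eq (head≡ w≤v) = head≡ (lex-∷ʳ⁻ w v (suc-injective eq) w≤v)

lex-∷ʳ⁺ : ∀ w v {c d} → length w ≡ length v → w ≤lex v → (w ≡ v → c ≤ₛ d)
  → (w ∷ʳ c) ≤lex (v ∷ʳ d)
lex-∷ʳ⁺ [] [] _ _ c≤d with ≤ₛ⇒<ₛ⊎≡ (c≤d refl)
... | inj₁ c<d = head< c<d
... | inj₂ refl = head≡ []≤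
lex-∷ʳ⁺ (a ∷ w) (b ∷ v) _ (head< a<b) _ = head< a<b
lex-∷ʳ⁺ (a ∷ w) (.a ∷ v) eq (head≡ w≤v) c≤d =
  head≡ (lex-∷ʳ⁺ w v (suc-injective eq) w≤v (c≤d ∘ cong (a ∷_)))

-- Rigidity of the lexicographic order on words of a fixed length

-- Reading words as base-3 numerals embeds the lexicographic order on words
-- of equal length into ℕ, which makes it well-founded.
base3 : Word → ℕ
base3 [] = 0
base3 (c ∷ w) = rank c * 3 ^ length w + base3 w

base3-< : ∀ w → base3 w < 3 ^ length w
base3-∷-< : ∀ c w → base3 (c ∷ w) < suc (rank c) * 3 ^ length w

base3-< [] = s≤s z≤n
base3-< (c ∷ w) = <-≤-trans (base3-∷-< c w) (*-monoˡ-≤ (3 ^ length w) (s≤s (rank≤2 c)))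

base3-∷-< c w = begin-strict
  rank c * 3 ^ length w + base3 w       <⟨ +-monoʳ-< (rank c * 3 ^ length w) (base3-< w) ⟩
  rank c * 3 ^ length w + 3 ^ length w  ≡⟨ +-comm (rank c * 3 ^ length w) (3 ^ length w) ⟩
  suc (rank c) * 3 ^ length w           ∎
  where open ≤-Reasoning

base3-head< : ∀ {c d} w v → c <ₛ d → length w ≡ length v → base3 (c ∷ w) < base3 (d ∷ v)
base3-head< {c} {d} w v c<d eq = begin-strict
  base3 (c ∷ w)                         <⟨ base3-∷-< c w ⟩
  suc (rank c) * 3 ^ length w           ≤⟨ *-monoˡ-≤ (3 ^ length w) c<d ⟩
  rank d * 3 ^ length w                 ≡⟨ cong (λ n → rank d * 3 ^ n) eq ⟩
  rank d * 3 ^ length v                 ≤⟨ m≤m+n (rank d * 3 ^ length v) (base3 v) ⟩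
  rank d * 3 ^ length v + base3 v       ∎
  where open ≤-Reasoning

base3-reflects-≤lex : ∀ w v → length w ≡ length v → base3 w ≤ base3 v → w ≤lex v
base3-reflects-≤lex [] [] _ _ = []≤
base3-reflects-≤lex (c ∷ w) (d ∷ v) eq le with <-cmp (rank c) (rank d)
... | tri< c<d _ _ = head< c<d
... | tri> _ _ d<c = ⊥-elim (<⇒≱ (base3-head< v w d<c (sym (suc-injective eq))) le)
... | tri≈ _ c≡d _ with rank-injective {c} {d} c≡d
...   | refl = head≡ (base3-reflects-≤lex w v (suc-injective eq) (+-cancelˡ-≤ (rank c * 3 ^ length v) _ _ le′))
  where
  le′ : rank c * 3 ^ length v + base3 w ≤ rank c * 3 ^ length v + base3 v
  le′ = subst (λ n → rank c * 3 ^ n + base3 w ≤ rank c * 3 ^ length v + base3 v) (suc-injective eq) le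

Monotone : ∀ {A B : Subset} → (El A → El B) → Set
Monotone {A} f = ∀ (x y : El A) → proj₁ x ≤lex proj₁ y → proj₁ (f x) ≤lex proj₁ (f y)

El-≡ : ∀ {A : Subset} {x y : El A} → proj₁ x ≡ proj₁ y → x ≡ y
El-≡ {x = w , p} {.w , q} refl = cong (w ,_) (Bool.T-irrelevant p q)

-- A least x with φ x <lex x would give the smaller φ x with φ (φ x) <lex φ x.
inflationary : ∀ {ℓ} {A : Subset} → (∀ (x : El A) → length (proj₁ x) ≡ ℓ)
  → (φ : El A → El A) → Monotone φ → (∀ {x y} → φ x ≡ φ y → x ≡ y)
  → ∀ x → proj₁ x ≤lex proj₁ (φ x)
inflationary {A = A} length-A φ φ-mono φ-inj x = go x (<-wellFounded (base3 (proj₁ x)))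
  where
  reflects : ∀ x y → base3 (proj₁ x) ≤ base3 (proj₁ y) → proj₁ x ≤lex proj₁ y
  reflects x y = base3-reflects-≤lex (proj₁ x) (proj₁ y) (trans (length-A x) (sym (length-A y)))

  go : ∀ x → Acc _<_ (base3 (proj₁ x)) → proj₁ x ≤lex proj₁ (φ x)
  go x (acc rec) with base3 (proj₁ x) ≤? base3 (proj₁ (φ x))
  ... | yes x≤φx = reflects x (φ x) x≤φx
  ... | no x≰φx = ⊥-elim (<-irrefl (cong (base3 ∘ proj₁) φx≡x) φx<x)
    where
    φx<x : base3 (proj₁ (φ x)) < base3 (proj₁ x)
    φx<x = ≰⇒> x≰φx
    φx≤x : proj₁ (φ x) ≤lex proj₁ x
    φx≤x = reflects (φ x) x (<⇒≤ φx<x)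
    φx≡x : φ x ≡ x
    φx≡x = φ-inj (El-≡ (lex-antisym (φ-mono (φ x) x φx≤x) (go (φ x) (rec φx<x))))

lex-automorphism-id : ∀ {ℓ} {A : Subset} → (∀ (x : El A) → length (proj₁ x) ≡ ℓ)
  → (φ ψ : El A → El A) → (∀ x → φ (ψ x) ≡ x) → (∀ x → ψ (φ x) ≡ x)
  → Monotone φ → Monotone ψ → ∀ x → φ x ≡ x
lex-automorphism-id length-A φ ψ φψ ψφ φ-mono ψ-mono x =
  El-≡ (lex-antisym φx≤x (inflationary length-A φ φ-mono φ-inj x))
  where
  φ-inj : ∀ {x y} → φ x ≡ φ y → x ≡ y
  φ-inj {x} {y} eq = trans (sym (ψφ x)) (trans (cong ψ eq) (ψφ y))
  ψ-inj : ∀ {x y} → ψ x ≡ ψ y → x ≡ y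
  ψ-inj {x} {y} eq = trans (sym (φψ x)) (trans (cong φ eq) (φψ y))
  φx≤x : proj₁ (φ x) ≤lex proj₁ x
  φx≤x = subst (λ z → proj₁ (φ x) ≤lex proj₁ z) (φψ x)
    (φ-mono x (ψ x) (inflationary length-A ψ ψ-mono ψ-inj x))

∈-allWords⁺ : ∀ ℓ {w} → length w ≡ ℓ → w ∈ allWords ℓ
∈-allWords⁺ zero {[]} refl = here refl
∈-allWords⁺ (suc ℓ) {L ∷ w} refl = ∈-++⁺ˡ (∈-map⁺ (L ∷_) (∈-allWords⁺ ℓ refl))
∈-allWords⁺ (suc ℓ) {X ∷ w} refl =
  ∈-++⁺ʳ (map (L ∷_) (allWords ℓ)) (∈-++⁺ˡ (∈-map⁺ (X ∷_) (∈-allWords⁺ ℓ refl)))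
∈-allWords⁺ (suc ℓ) {R ∷ w} refl =
  ∈-++⁺ʳ (map (L ∷_) (allWords ℓ))
    (∈-++⁺ʳ (map (X ∷_) (allWords ℓ)) (∈-++⁺ˡ (∈-map⁺ (R ∷_) (∈-allWords⁺ ℓ refl))))

∈-allWords⁻ : ∀ ℓ {w} → w ∈ allWords ℓ → length w ≡ ℓ
∈-allWords⁻ zero (here refl) = refl
∈-allWords⁻ (suc ℓ) = extensions (L ∷ X ∷ R ∷ [])
  where
  extensions : ∀ cs {u} → u ∈ concatMap (λ c → map (c ∷_) (allWords ℓ)) cs → length u ≡ suc ℓ
  extensions (c ∷ cs) u∈ with ∈-++⁻ (map (c ∷_) (allWords ℓ)) u∈
  ... | inj₂ u∈cs = extensions cs u∈cs
  ... | inj₁ u∈c with ∈-map⁻ (c ∷_) u∈c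
  ...   | _ , w∈ , refl = cong suc (∈-allWords⁻ ℓ w∈)

allWords-unique : ∀ ℓ → Unique (allWords ℓ)
allWords-unique zero = [] ∷ []
allWords-unique (suc ℓ) =
  Unique.concat⁺ (block L ∷ block X ∷ block R ∷ [])
    ((blocks-disjoint (λ ()) ∷ blocks-disjoint (λ ()) ∷ []) ∷ (blocks-disjoint (λ ()) ∷ []) ∷ [] ∷ [])
  where
  block : ∀ c → Unique (map (c ∷_) (allWords ℓ))
  block c = Unique.map⁺ (proj₂ ∘ ∷-injective) (allWords-unique ℓ)

  blocks-disjoint : ∀ {c d} → c ≢ d → Disjoint (map (c ∷_) (allWords ℓ)) (map (d ∷_) (allWords ℓ))
  blocks-disjoint {c} {d} c≢d (u∈c , u∈d) with ∈-map⁻ (c ∷_) u∈c | ∈-map⁻ (d ∷_) u∈d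
  ... | _ , _ , refl | _ , _ , eq = c≢d (proj₁ (∷-injective eq))

lookup-injective : ∀ {A : Set} {xs : List A} → Unique xs → ∀ {i j} → lookup xs i ≡ lookup xs j → i ≡ j
lookup-injective (_ ∷ _) {Fin.zero} {Fin.zero} _ = refl
lookup-injective (x≢ ∷ _) {Fin.zero} {Fin.suc j} eq = ⊥-elim (All.lookup x≢ (∈-lookup j) eq)
lookup-injective (x≢ ∷ _) {Fin.suc i} {Fin.zero} eq = ⊥-elim (All.lookup x≢ (∈-lookup i) (sym eq))
lookup-injective (_ ∷ u) {Fin.suc i} {Fin.suc j} eq = cong Fin.suc (lookup-injective u eq)

record Represents (ℓ : ℕ) (e : Vec Sym (length (allWords ℓ))) (F : Word → Sym) : Set where
  field
    letter-at : ∀ i → Vec.lookup e i ≡ F (lookup (allWords ℓ) i)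

open Represents

letterOf : ∀ ℓ → Vec Sym (length (allWords ℓ)) → Word → Sym
letterOf ℓ e w with w ∈? allWords ℓ
... | yes w∈ = Vec.lookup e (Any.index w∈)
... | no _ = L

represents-letterOf : ∀ ℓ e → Represents ℓ e (letterOf ℓ e)
letter-at (represents-letterOf ℓ e) i with lookup (allWords ℓ) i ∈? allWords ℓ
... | yes w∈ = cong (Vec.lookup e) (lookup-injective (allWords-unique ℓ) (lookup-index w∈))
... | no w∉ = ⊥-elim (w∉ (∈-lookup i))

represents-take : ∀ {ℓ ℓ'} {e : Vec Sym (length (allWords ℓ))} {e' : Vec Sym (length (allWords ℓ'))} {F}
  → ℓ ≤ ℓ'
  → (∀ i j → (lookup (allWords ℓ') i ∣ ℓ) ≡ lookup (allWords ℓ) j → Vec.lookup e' i ≡ Vec.lookup e j)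
  → Represents ℓ e F → Represents ℓ' e' (F ∘ take ℓ)
letter-at (represents-take {ℓ} {ℓ'} {e} {e'} {F} ℓ≤ℓ' agree rep) i = begin
  Vec.lookup e' i             ≡⟨ agree i j (lookup-index w∈) ⟩
  Vec.lookup e j              ≡⟨ letter-at rep j ⟩
  F (lookup (allWords ℓ) j)   ≡⟨ cong F (lookup-index w∈) ⟨
  F w                         ∎
  where
  open ≡-Reasoning
  w : Word
  w = take ℓ (lookup (allWords ℓ') i)
  w∈ : w ∈ allWords ℓ
  w∈ = ∈-allWords⁺ ℓ (length-take-≤ _ (subst (ℓ ≤_) (sym (∈-allWords⁻ ℓ' (∈-lookup i))) ℓ≤ℓ'))
  j : Fin (length (allWords ℓ))
  j = Any.index w∈

record IsWords (ℓ : ℕ) (A : Subset) : Set where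
  field
    length-∈ : ∀ {w} → T (A w) → length w ≡ ℓ
    ∈-length : ∀ {w} → length w ≡ ℓ → T (A w)

record IsGraph (ℓ : ℕ) (F : Word → Sym) (B : Subset) : Set where
  field
    graph-∈ : ∀ {u} → T (B u) → ∃[ w ] (length w ≡ ℓ × u ≡ w ∷ʳ F w)
    ∈-graph : ∀ {w} → length w ≡ ℓ → T (B (w ∷ʳ F w))

length-∷ʳ : ∀ (w : Word) {c} → length (w ∷ʳ c) ≡ suc (length w)
length-∷ʳ [] = refl
length-∷ʳ (_ ∷ w) = cong suc (length-∷ʳ w)

levelOf⇔ : ∀ A i w → T (levelOf A i w) ⇔ (T (A w) × length w ≡ i)
levelOf⇔ A i w = mk⇔
  (Product.map₂ (≡ᵇ⇒≡ (length w) i) ∘ Equivalence.to Bool.T-∧)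
  (Equivalence.from Bool.T-∧ ∘ Product.map₂ (≡⇒≡ᵇ (length w) i))

isPrefix-++ : ∀ w x → T (isPrefix w (w ++ x))
isPrefix-++ [] x = tt
isPrefix-++ (c ∷ w) x = Equivalence.from Bool.T-∧ (==ₛ-refl c , isPrefix-++ w x)

isPrefix-refl : ∀ w → T (isPrefix w w)
isPrefix-refl [] = tt
isPrefix-refl (c ∷ w) = Equivalence.from Bool.T-∧ (==ₛ-refl c , isPrefix-refl w)

isPrefix⇒≡ : ∀ u s → T (isPrefix u s) → length u ≡ length s → u ≡ s
isPrefix⇒≡ [] [] _ _ = refl
isPrefix⇒≡ (c ∷ u) (d ∷ s) u≤s eq with Equivalence.to Bool.T-∧ u≤s
... | c=d , u≤s′ = cong₂ _∷_ (==ₛ⇒≡ c d c=d) (isPrefix⇒≡ u s u≤s′ (suc-injective eq))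

∈-extend⁻ : ∀ (A : List Word) e {u} → u ∈ extend A e → ∃[ i ] (u ≡ lookup A i ∷ʳ Vec.lookup e i)
∈-extend⁻ [] Vec.[] ()
∈-extend⁻ (_ ∷ _) (_ Vec.∷ _) (here refl) = Fin.zero , refl
∈-extend⁻ (_ ∷ A) (_ Vec.∷ e) (there u∈) = Product.map Fin.suc id (∈-extend⁻ A e u∈)

∈-extend⁺ : ∀ (A : List Word) e i → lookup A i ∷ʳ Vec.lookup e i ∈ extend A e
∈-extend⁺ (_ ∷ _) (_ Vec.∷ _) Fin.zero = here refl
∈-extend⁺ (_ ∷ A) (_ Vec.∷ e) (Fin.suc i) = there (∈-extend⁺ A e i)

module Extension (ℓ : ℕ) (e : Vec Sym (length (allWords ℓ))) where

  S : List Word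
  S = extend (allWords ℓ) e

  prefix-∈-closure : ∀ u {w} (w∈ : w ∈ allWords ℓ)
    → T (isPrefix u (w ∷ʳ Vec.lookup e (Any.index w∈))) → T (closure S u)
  prefix-∈-closure u w∈ prefix =
    any⁺ (isPrefix u) (lose (∈-extend⁺ (allWords ℓ) e (Any.index w∈)) prefix′)
    where
    prefix′ : T (isPrefix u (lookup (allWords ℓ) (Any.index w∈) ∷ʳ Vec.lookup e (Any.index w∈)))
    prefix′ = subst (λ a → T (isPrefix u (a ∷ʳ Vec.lookup e (Any.index w∈)))) (lookup-index w∈) prefix

  lower-level : IsWords ℓ (levelOf (closure S) ℓ)
  lower-level = record
    { length-∈ = λ {w} → proj₂ ∘ Equivalence.to (levelOf⇔ (closure S) ℓ w)
    ; ∈-length = λ {w} len → Equivalence.from (levelOf⇔ (closure S) ℓ w)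
                   (prefix-∈-closure w (∈-allWords⁺ ℓ len) (isPrefix-++ w _) , len)
    }

  upper-level : ∀ {F} → Represents ℓ e F → IsGraph ℓ F (levelOf (closure S) (suc ℓ))
  upper-level {F} rep = record { graph-∈ = graph-∈ ; ∈-graph = λ {w} → ∈-graph {w} }
    where
    graph-∈ : ∀ {u} → T (levelOf (closure S) (suc ℓ) u) → ∃[ w ] (length w ≡ ℓ × u ≡ w ∷ʳ F w)
    graph-∈ {u} u∈ with Equivalence.to (levelOf⇔ (closure S) (suc ℓ) u) u∈
    ... | u∈S̄ , len with find (any⁻ (isPrefix u) S u∈S̄)
    ... | s , s∈ , prefix with ∈-extend⁻ (allWords ℓ) e s∈
    ... | i , refl = w , length-w , trans u≡s (cong (w ∷ʳ_) (letter-at rep i))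
      where
      w : Word
      w = lookup (allWords ℓ) i
      length-w : length w ≡ ℓ
      length-w = ∈-allWords⁻ ℓ (∈-lookup i)
      u≡s : u ≡ w ∷ʳ Vec.lookup e i
      u≡s = isPrefix⇒≡ u _ prefix (trans len (sym (trans (length-∷ʳ w) (cong suc length-w))))

    ∈-graph : ∀ {w} → length w ≡ ℓ → T (levelOf (closure S) (suc ℓ) (w ∷ʳ F w))
    ∈-graph {w} len = Equivalence.from (levelOf⇔ (closure S) (suc ℓ) (w ∷ʳ F w))
      (prefix-∈-closure (w ∷ʳ F w) w∈ prefix , trans (length-∷ʳ w) (cong suc len))
      where
      w∈ : w ∈ allWords ℓ
      w∈ = ∈-allWords⁺ ℓ len
      letter : F w ≡ Vec.lookup e (Any.index w∈)
      letter = trans (cong F (lookup-index w∈)) (sym (letter-at rep (Any.index w∈)))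
      prefix : T (isPrefix (w ∷ʳ F w) (w ∷ʳ Vec.lookup e (Any.index w∈)))
      prefix = subst (λ c → T (isPrefix (w ∷ʳ F w) (w ∷ʳ c))) letter (isPrefix-refl (w ∷ʳ F w))

  no-word-of-length : ∀ {u} → u ∈ S → length u ≢ ℓ
  no-word-of-length u∈ len with ∈-extend⁻ (allWords ℓ) e u∈
  ... | i , refl =
    1+n≢n (trans (sym (length-∷ʳ (lookup (allWords ℓ) i))) (trans len (sym (∈-allWords⁻ ℓ (∈-lookup i)))))

-- Boring extensions, letter by letter

CompatibilityPreserving : ℕ → (Word → Sym) → Set
CompatibilityPreserving ℓ F = ∀ {w v} → length w ≡ ℓ → length v ≡ ℓ
  → (w ∷ʳ F w) ≤lex (v ∷ʳ F v) → Compat (pairs w v) → Compat (pairs w v ∷ʳ (F w , F v))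

record BoringLetters (ℓ : ℕ) (F : Word → Sym) : Set where
  field
    monotone   : ∀ {w v} → length w ≡ ℓ → length v ≡ ℓ → All Ordered (pairs w v) → F w ≤ₛ F v
    separating : ∀ {w v} → length w ≡ ℓ → length v ≡ ℓ → All Ordered (pairs w v)
               → F w ≡ L → F v ≡ R → Crosses (pairs w v)
    compatible : CompatibilityPreserving ℓ F

module GraphLevel {ℓ F A B} (words : IsWords ℓ A) (graph : IsGraph ℓ F B) where
  open IsWords words
  open IsGraph graph

  length-A : ∀ (x : El A) → length (proj₁ x) ≡ ℓ
  length-A x = length-∈ (proj₂ x)

  same-length : ∀ (x y : El A) → length (proj₁ x) ≡ length (proj₁ y)
  same-length x y = trans (length-A x) (sym (length-A y))

  attach : El A → El B
  attach (w , w∈) = w ∷ʳ F w , ∈-graph (length-∈ w∈)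

  detach : El B → El A
  detach (u , u∈) = proj₁ (graph-∈ u∈) , ∈-length (proj₁ (proj₂ (graph-∈ u∈)))

  attach-detach-word : ∀ y → proj₁ y ≡ proj₁ (attach (detach y))
  attach-detach-word (u , u∈) = proj₂ (proj₂ (graph-∈ u∈))

  attach-detach : ∀ y → attach (detach y) ≡ y
  attach-detach y = El-≡ (sym (attach-detach-word y))

  detach-attach : ∀ x → detach (attach x) ≡ x
  detach-attach x = El-≡ (∷ʳ-injectiveˡ _ (proj₁ x) (sym (attach-detach-word (attach x))))

  attach-monotone : Monotone attach
  attach-monotone x y x≤y =
    lex-∷ʳ⁺ (proj₁ x) (proj₁ y) (same-length x y) x≤y (λ eq → ≤-reflexive (cong (rank ∘ F) eq))

  detach-monotone : Monotone detach
  detach-monotone x y x≤y = lex-∷ʳ⁻ _ _ (same-length (detach x) (detach y))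
    (subst₂ _≤lex_ (attach-detach-word x) (attach-detach-word y) x≤y)

  pairs-attach : ∀ x y → pairs (proj₁ (attach x)) (proj₁ (attach y))
                       ≡ pairs (proj₁ x) (proj₁ y) ∷ʳ (F (proj₁ x) , F (proj₁ y))
  pairs-attach x y = pairs-∷ʳ (proj₁ x) (proj₁ y) (same-length x y)

  Corresponding : El A → El A → El B → El B → Set
  Corresponding x y a b =
      ((proj₁ x ≤lex proj₁ y) ⇔ (proj₁ a ≤lex proj₁ b))
    × ((proj₁ x ≼ proj₁ y) ⇔ (proj₁ a ≼ proj₁ b))
    × ((proj₁ x ⊴ proj₁ y) ⇔ (proj₁ a ⊴ proj₁ b))

  Preserves : (El A → El B) → Set
  Preserves f = ∀ x y → Corresponding x y (f x) (f y)

  boringLetters⇒levelIso : BoringLetters ℓ F → LevelIso A B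
  boringLetters⇒levelIso letters = mk↔ₛ′ attach detach attach-detach detach-attach , preserves
    where
    open BoringLetters letters

    preserves : Preserves attach
    preserves x y =
        mk⇔ (attach-monotone x y) (subst₂ _≤lex_ (cong proj₁ (detach-attach x)) (cong proj₁ (detach-attach y))
                                      ∘ detach-monotone (attach x) (attach y))
      , mk⇔ ≼-to ≼-from
      , mk⇔ ⊴-to ⊴-from
      where
      w v : Word
      w = proj₁ x
      v = proj₁ y
      ps : Pairs
      ps = pairs w v
      lw : length w ≡ ℓ
      lw = length-A x
      lv : length v ≡ ℓ
      lv = length-A y
      ps-attach : pairs (w ∷ʳ F w) (v ∷ʳ F v) ≡ ps ∷ʳ (F w , F v)
      ps-attach = pairs-attach x y

      ≼-to : w ≼ v → (w ∷ʳ F w) ≼ (v ∷ʳ F v)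
      ≼-to (inj₁ w≺v) = inj₁ (Equivalence.from (≺⇔crosses _ _)
        (subst Crosses (sym ps-attach) (crosses-++ _ (Equivalence.to (≺⇔crosses w v) w≺v))))
      ≼-to (inj₂ w≡v) = inj₂ (cong (λ u → u ∷ʳ F u) w≡v)

      ≼-from : (w ∷ʳ F w) ≼ (v ∷ʳ F v) → w ≼ v
      ≼-from (inj₂ eq) = inj₂ (∷ʳ-injectiveˡ w v eq)
      ≼-from (inj₁ ≺′) with crosses-∷ʳ⁻ ps (subst Crosses ps-attach (Equivalence.to (≺⇔crosses _ _) ≺′))
      ... | inj₁ crosses = inj₁ (Equivalence.from (≺⇔crosses w v) crosses)
      ... | inj₂ (ordered , LR) =
        inj₁ (Equivalence.from (≺⇔crosses w v) (separating lw lv ordered (cong proj₁ LR) (cong proj₂ LR)))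

      ⊴-to : w ⊴ v → (w ∷ʳ F w) ⊴ (v ∷ʳ F v)
      ⊴-to w⊴v = Equivalence.from (⊴⇔ordered _ _)
        (subst (All Ordered) (sym ps-attach) (∷ʳ⁺ ordered (monotone lw lv ordered)))
        where
        ordered : All Ordered ps
        ordered = Equivalence.to (⊴⇔ordered w v) w⊴v

      ⊴-from : (w ∷ʳ F w) ⊴ (v ∷ʳ F v) → w ⊴ v
      ⊴-from ⊴′ = Equivalence.from (⊴⇔ordered w v)
        (proj₁ (∷ʳ⁻ (subst (All Ordered) ps-attach (Equivalence.to (⊴⇔ordered _ _) ⊴′))))

  -- Any isomorphism of the level structures is an order isomorphism for
  -- ≤lex, as is attach; they differ by a lex-automorphism of A, which is trivial.
  levelIso-attach : (iso : LevelIso A B) → ∀ x → Inverse.to (proj₁ iso) x ≡ attach x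
  levelIso-attach (f , preserves) x =
    trans (sym (attach-detach (to x)))
      (cong attach (lex-automorphism-id length-A φ ψ φψ ψφ φ-monotone ψ-monotone x))
    where
    open Inverse f using (to; from; strictlyInverseˡ; strictlyInverseʳ)

    φ ψ : El A → El A
    φ = detach ∘ to
    ψ = from ∘ attach

    φψ : ∀ x → φ (ψ x) ≡ x
    φψ x = trans (cong detach (strictlyInverseˡ (attach x))) (detach-attach x)

    ψφ : ∀ x → ψ (φ x) ≡ x
    ψφ x = trans (cong from (attach-detach (to x))) (strictlyInverseʳ x)

    from-monotone : Monotone from
    from-monotone u v u≤v = Equivalence.from (proj₁ (preserves (from u) (from v)))
      (subst₂ _≤lex_ (sym (cong proj₁ (strictlyInverseˡ u))) (sym (cong proj₁ (strictlyInverseˡ v))) u≤v)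

    φ-monotone : Monotone φ
    φ-monotone x y = detach-monotone (to x) (to y) ∘ Equivalence.to (proj₁ (preserves x y))

    ψ-monotone : Monotone ψ
    ψ-monotone x y = from-monotone (attach x) (attach y) ∘ attach-monotone x y

  levelIso-preserves-attach : LevelIso A B → Preserves attach
  levelIso-preserves-attach iso@(_ , preserves) x y =
    subst₂ (Corresponding x y) (levelIso-attach iso x) (levelIso-attach iso y) (preserves x y)

  module _ (iso : LevelIso A B) {w v : Word} (lw : length w ≡ ℓ) (lv : length v ≡ ℓ) where
    private
      x y : El A
      x = w , ∈-length lw
      y = v , ∈-length lv

    levelIso⇒monotone : All Ordered (pairs w v) → F w ≤ₛ F v
    levelIso⇒monotone ordered = proj₂ (∷ʳ⁻ (subst (All Ordered) (pairs-attach x y)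
      (Equivalence.to (⊴⇔ordered _ _) (Equivalence.to (proj₂ (proj₂ (levelIso-preserves-attach iso x y)))
        (Equivalence.from (⊴⇔ordered w v) ordered)))))

    levelIso⇒separating : All Ordered (pairs w v) → F w ≡ L → F v ≡ R → Crosses (pairs w v)
    levelIso⇒separating ordered Fw≡L Fv≡R
      with Equivalence.from (proj₁ (proj₂ (levelIso-preserves-attach iso x y))) (inj₁ attached-≺)
      where
      attached-≺ : (w ∷ʳ F w) ≺ (v ∷ʳ F v)
      attached-≺ = Equivalence.from (≺⇔crosses _ _) (subst Crosses (sym (pairs-attach x y))
        (subst₂ (λ c d → Crosses (pairs w v ∷ʳ (c , d))) (sym Fw≡L) (sym Fv≡R) (crosses-∷ʳ ordered)))
    ... | inj₁ w≺v = Equivalence.to (≺⇔crosses w v) w≺v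
    ... | inj₂ refl with () ← trans (sym Fw≡L) Fv≡R

  IncompatibleExtension : Set
  IncompatibleExtension = ∃[ u ] ∃[ v ]
    (T (B u) × T (B v) × u ≤lex v × ¬ Compatible u v × Compatible (u ∣ ℓ) (v ∣ ℓ))

  compatible⇒¬incompatible : CompatibilityPreserving ℓ F → ¬ IncompatibleExtension
  compatible⇒¬incompatible preserving (u , v , u∈ , v∈ , u≤v , ¬compat , compat∣)
    with graph-∈ u∈ | graph-∈ v∈
  ... | w , lw , refl | v′ , lv′ , refl =
    ¬compat (Equivalence.from (compatible⇔compat _ _)
      (subst Compat (sym (pairs-∷ʳ w v′ (trans lw (sym lv′))))
        (preserving lw lv′ u≤v (Equivalence.to (compatible⇔compat w v′)
          (subst₂ Compatible (take-∷ʳ w lw) (take-∷ʳ v′ lv′) compat∣)))))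

  ¬incompatible⇒compatible : ¬ IncompatibleExtension → CompatibilityPreserving ℓ F
  ¬incompatible⇒compatible ¬incompatible {w} {v} lw lv le compat = compat-stable λ ¬compat →
    ¬incompatible (w ∷ʳ F w , v ∷ʳ F v , ∈-graph lw , ∈-graph lv , le ,
      ¬compat ∘ subst Compat (pairs-∷ʳ w v (trans lw (sym lv))) ∘ Equivalence.to (compatible⇔compat _ _) ,
      Equivalence.from (compatible⇔compat _ _)
        (subst₂ (λ a b → Compat (pairs a b)) (sym (take-∷ʳ w lw)) (sym (take-∷ʳ v lv)) compat))

module _ {ℓ} {e : Vec Sym (length (allWords ℓ))} {F} (rep : Represents ℓ e F) where
  open Extension ℓ e
  open GraphLevel lower-level (upper-level {F} rep)

  boringLetters⇒boring : BoringLetters ℓ F → Boring ℓ (allWords ℓ) e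
  boringLetters⇒boring letters (inj₁ ¬iso) = ¬iso (boringLetters⇒levelIso letters)
  boringLetters⇒boring letters (inj₂ (inj₁ incompatible)) =
    compatible⇒¬incompatible (BoringLetters.compatible letters) incompatible
  boringLetters⇒boring letters (inj₂ (inj₂ (u , u∈ , len))) = no-word-of-length u∈ len

  -- Boring only refutes the absence of an isomorphism, hence the double negation.
  boring⇒¬¬boringLetters : Boring ℓ (allWords ℓ) e → ¬ ¬ BoringLetters ℓ F
  boring⇒¬¬boringLetters boring ¬letters = boring (inj₁ λ iso → ¬letters record
    { monotone   = levelIso⇒monotone iso
    ; separating = levelIso⇒separating iso
    ; compatible = ¬incompatible⇒compatible (boring ∘ inj₂ ∘ inj₁)
    })

boringLetters-take : ∀ {ℓ ℓ' F} → ℓ ≤ ℓ' → BoringLetters ℓ F → BoringLetters ℓ' (F ∘ take ℓ)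
boringLetters-take {ℓ} {ℓ'} {F} ℓ≤ℓ' letters = record
  { monotone   = λ {a} {b} la lb → monotone (truncated la) (truncated lb) ∘ ordered-take ℓ a b
  ; separating = λ {a} {b} la lb ordered Fa≡L Fb≡R →
      crosses-take ℓ a b (separating (truncated la) (truncated lb) (ordered-take ℓ a b ordered) Fa≡L Fb≡R)
  ; compatible = compatible′
  }
  where
  open BoringLetters letters

  truncated : ∀ {a} → length a ≡ ℓ' → length (take ℓ a) ≡ ℓ
  truncated {a} la = length-take-≤ a (subst (ℓ ≤_) (sym la) ℓ≤ℓ')

  compatible′ : CompatibilityPreserving ℓ' (F ∘ take ℓ)
  compatible′ {a} {b} la lb le compat =
    subst (λ ps → Compat (ps ∷ʳ (F a₀ , F b₀))) (pairs-take++drop ℓ a b)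
      (compat-∷ʳ (pairs a₀ b₀) (pairs (drop ℓ a) (drop ℓ b))
        (subst Compat (sym (pairs-take++drop ℓ a b)) compat)
        (compatible (truncated la) (truncated lb) le₀ (compat-take ℓ a b compat))
        (monotone (truncated la) (truncated lb))
        (λ ordered LR → separating (truncated la) (truncated lb) ordered (cong proj₁ LR) (cong proj₂ LR)))
    where
    a₀ b₀ : Word
    a₀ = take ℓ a
    b₀ = take ℓ b
    le₀ : (a₀ ∷ʳ F a₀) ≤lex (b₀ ∷ʳ F b₀)
    le₀ = lex-∷ʳ⁺ a₀ b₀ (trans (truncated la) (sym (truncated lb)))
      (lex-take ℓ (lex-∷ʳ⁻ a b (trans la (sym lb)) le)) (λ eq → ≤-reflexive (cong (rank ∘ F) eq))

mainTheorem6 : (ℓ ℓ' : ℕ) → ℓ ≤ ℓ'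
  → (e : Vec Sym (length (allWords ℓ)))
  → Boring ℓ (allWords ℓ) e
  → (e' : Vec Sym (length (allWords ℓ')))
  → (∀ (i : Fin (length (allWords ℓ'))) (j : Fin (length (allWords ℓ)))
       → (lookup (allWords ℓ') i ∣ ℓ) ≡ lookup (allWords ℓ) j
       → Vec.lookup e' i ≡ Vec.lookup e j)
  → Boring ℓ' (allWords ℓ') e'
mainTheorem6 ℓ ℓ' ℓ≤ℓ' e boring e' agree interesting =
  boring⇒¬¬boringLetters rep boring λ letters →
    boringLetters⇒boring (represents-take ℓ≤ℓ' agree rep) (boringLetters-take ℓ≤ℓ' letters) interesting
  where
  rep : Represents ℓ e (letterOf ℓ e)
  rep = represents-letterOf ℓ e
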